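{- Let $M\subseteq\mathbb{T}$ satisfy the standing hypothesis. The complete shell $\mathrm{shell}_{\curvearrowleft}(\rho^\forall_M)$ of the universal closure for time reversal exists, its set of fixpoints is the closure under arbitrary unions of $\{Y\mid Y\text{ a fixpoint of }\rho^\forall_M\}\cup\{Y\subseteq\mathbb{T}\mid\curvearrowleft Y\text{ is a fixpoint of }\rho^\forall_M\}$, and $\mathrm{shell}_{\curvearrowleft}(\rho^\forall_M)=\rho^\forall_M\sqcap\rho^\forall_{\curvearrowleft M}$.
   Context: $\mathbb{T}$ is the set of traces $\langle i,\sigma\rangle$, $i\in\mathbb{Z}$, $\sigma:\mathbb{Z}\to\mathbb{S}$; $X_{\downarrow s}=\{\langle i,\sigma\rangle\in X\mid\sigma_i=s\}$; $\oplus(X)=\{\langle i,\sigma\rangle\mid\langle i+1,\sigma\rangle\in X\}$, $\ominus(X)=\{\langle i,\sigma\rangle\mid\langle i-1,\sigma\rangle\in X\}$, $\curvearrowleft(X)=\{\langle -i,\lambda k.\sigma_{ -k}\rangle\mid\langle i,\sigma\rangle\in X\}$. Standing hypothesis on $M$: (i) $|M_{\downarrow s}|>1$ for all $s$; (ii) $\oplus(M)=M=\ominus(M)$ and $\oplus(\curvearrowleft M)=\curvearrowleft M=\ominus(\curvearrowleft M)$. For a model $N$, $\rho^\forall_N(X)=\{\langle i,\sigma\rangle\in N\mid N_{\downarrow\sigma_i}\subseteq X\}$. Upper closure operators on $\langle\wp(\mathbb{T}),\supseteq\rangle$: maps monotone w.r.t. $\subseteq$, idempotent, with $\rho(X)\subseteq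 X$; ordered by $\rho\sqsubseteq\eta$ iff $\rho(X)\supseteq\eta(X)$ for all $X$; identified with their sets of fixpoints; the glb $\rho\sqcap\eta$ is the closure whose set of fixpoints is the closure under arbitrary unions of the union of their sets of fixpoints (equivalently $(\rho\sqcap\eta)(X)=\rho(X)\cup\eta(X)$). $\rho$ is complete for $f$ if $\rho\circ f=\rho\circ f\circ\rho$. The complete shell of $\rho$ for $f$ is the $\sqsubseteq$-greatest closure $\eta\sqsubseteq\rho$ complete for $f$. -}

module Defs where

open import Level using (0ℓ)
open import Data.Integer using (ℤ; _+_; _-_; -_; 1ℤ)
open import Data.Product using (Σ; Σ-syntax; _×_; _,_; proj₁; proj₂)
open import Relation.Unary using (Pred; _⊆_; _≐_; _∪_; ⋃)
open import Relation.Binary.PropositionalEquality using (_≡_)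
open import Relation.Nullary using (¬_)

module Traces (S : Set) where

  Trace : Set
  Trace = ℤ × (ℤ → S)

  TSet : Set₁
  TSet = Pred Trace 0ℓ

  state : Trace → S
  state (i , σ) = σ i

  _↓_ : TSet → S → TSet
  (X ↓ s) t = Σ (X t) λ _ → state t ≡ s

  ⊕ : TSet → TSet
  ⊕ X (i , σ) = X (i + 1ℤ , σ)

  ⊖ : TSet → TSet
  ⊖ X (i , σ) = X (i - 1ℤ , σ)

  rev : Trace → Trace
  rev (i , σ) = (- i , λ k → σ (- k))

  ↶ : TSet → TSet
  ↶ X t = Σ Trace λ u → X u × (t ≡ rev u)

  StandingHyp : TSet → Set
  StandingHyp M =
    (∀ (s : S) → Σ Trace λ t → Σ Trace λ u → (M ↓ s) t × (M ↓ s) u × ¬ (t ≡ u))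
    × (⊕ M ≐ M) × (M ≐ ⊖ M)
    × (⊕ (↶ M) ≐ ↶ M) × (↶ M ≐ ⊖ (↶ M))

  ρ∀ : TSet → TSet → TSet
  ρ∀ N X t = N t × ((N ↓ state t) ⊆ X)

  Op : Set₁
  Op = TSet → TSet

  -- upper closure operator on ⟨℘(𝕋), ⊇⟩
  IsUco : Op → Set₁
  IsUco ρ = (∀ {X Y} → X ⊆ Y → ρ X ⊆ ρ Y)
          × (∀ X → ρ X ⊆ X)
          × (∀ X → ρ (ρ X) ≐ ρ X)

  _⊑_ : Op → Op → Set₁
  ρ ⊑ η = ∀ X → η X ⊆ ρ X

  _⊓_ : Op → Op → Op
  (ρ ⊓ η) X = ρ X ∪ η X

  Complete : Op → Op → Set₁
  Complete ρ f = ∀ X → ρ (f X) ≐ ρ (f (ρ X))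

  Fix : Op → TSet → Set
  Fix ρ Y = ρ Y ≐ Y

  UnionClosure : (TSet → Set) → TSet → Set₁
  UnionClosure 𝓕 Y =
    Σ Set λ I → Σ (I → TSet) λ Z → (∀ i → 𝓕 (Z i)) × (Y ≐ ⋃ I Z)

  IsCompleteShell : Op → Op → Op → Set₁
  IsCompleteShell ρ f η =
    IsUco η × (η ⊑ ρ) × Complete η f
    × (∀ η′ → IsUco η′ → η′ ⊑ ρ → Complete η′ f → η′ ⊑ η)

{-# OPTIONS --safe #-}
-- For an upper closure ρ and a monotone involution f, the conjugate ρ˘ = f ∘ ρ ∘ f is an upper
-- closure whose fixpoints are the f-images of those of ρ. If η ⊑ ρ is complete for f, then f
-- maps fixpoints of η to fixpoints of η, so η has all fixpoints of ρ and of ρ˘, i.e. η ⊑ ρ ⊓ ρ˘.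
-- Conversely ρ ⊓ ρ˘ is complete for f, since f exchanges the two halves. Reversal preserves
-- the current state, so the conjugate of ρ^∀_M under ↶ is ρ^∀_{↶M}.
module Submission where

open import Defs
open import Level using (0ℓ)
open import Data.Bool using (Bool; true; false)
open import Data.Product using (Σ; _×_; _,_; proj₁; proj₂)
open import Data.Sum as Sum using (_⊎_; inj₁; inj₂; [_,_])
open import Data.Integer.Properties using (neg-involutive)
open import Function.Base using (_∘_)
open import Function.Bundles using (_⇔_; mk⇔; Equivalence)
open import Function.Construct.Composition using (_⇔-∘_)
open import Relation.Unary using (_≐_; _⊆_; ⋃)
open import Relation.Unary.Properties using (≐-sym; ≐-trans)
open import Relation.Binary.PropositionalEquality using (_≡_; refl; sym; trans; cong; cong₂; subst)
open import Axiom.Extensionality.Propositional using (Extensionality)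

module ClosureTheory (S : Set) where
  open Traces S

  Monotone : Op → Set₁
  Monotone ρ = ∀ {X Y} → X ⊆ Y → ρ X ⊆ ρ Y

  module Uco {ρ : Op} (uco : IsUco ρ) where

    mono : Monotone ρ
    mono = proj₁ uco

    reductive : ∀ X → ρ X ⊆ X
    reductive = proj₁ (proj₂ uco)

    idempotent : ∀ X → Fix ρ (ρ X)
    idempotent = proj₂ (proj₂ uco)

    idempotent-⊇ : ∀ X → ρ X ⊆ ρ (ρ X)
    idempotent-⊇ X = proj₂ (idempotent X)

    Fix⇒⊆-mono : ∀ {Z Y} → Fix ρ Z → Z ⊆ Y → Z ⊆ ρ Y
    Fix⇒⊆-mono fix Z⊆Y = mono Z⊆Y ∘ proj₂ fix

  ⊑-Fix : ∀ {ρ η} → IsUco η → η ⊑ ρ → ∀ {Z} → Fix ρ Z → Fix η Z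
  ⊑-Fix η-uco η⊑ρ {Z} fix = Uco.reductive η-uco Z , η⊑ρ Z ∘ proj₂ fix

  UnionClosure-mono : ∀ {𝓕 𝓖 : TSet → Set} → (∀ Z → 𝓕 Z → 𝓖 Z) →
                      ∀ {Y} → UnionClosure 𝓕 Y → UnionClosure 𝓖 Y
  UnionClosure-mono 𝓕⊆𝓖 (I , Z , 𝓕Z , Y≐⋃Z) = I , Z , (λ i → 𝓕⊆𝓖 (Z i) (𝓕Z i)) , Y≐⋃Z

  module Meet {ρ η : Op} (ρ-uco : IsUco ρ) (η-uco : IsUco η) where
    private
      module ρ = Uco ρ-uco
      module η = Uco η-uco

    ⊓-reductive : ∀ X → (ρ ⊓ η) X ⊆ X
    ⊓-reductive X = [ ρ.reductive X , η.reductive X ]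

    ⊓-isUco : IsUco (ρ ⊓ η)
    ⊓-isUco = (λ X⊆Y → Sum.map (ρ.mono X⊆Y) (η.mono X⊆Y))
            , ⊓-reductive
            , λ X → ⊓-reductive ((ρ ⊓ η) X)
                  , Sum.map (ρ.mono inj₁ ∘ ρ.idempotent-⊇ X) (η.mono inj₂ ∘ η.idempotent-⊇ X)

    ⊓≐⋃ : ∀ Y → (ρ ⊓ η) Y ≐ ⋃ Bool (λ { true → ρ Y ; false → η Y })
    ⊓≐⋃ Y = [ true ,_ , false ,_ ] , λ { (true , r) → inj₁ r ; (false , r) → inj₂ r }

    Fix-⊓ : ∀ Y → Fix (ρ ⊓ η) Y ⇔ UnionClosure (λ Z → Fix ρ Z ⊎ Fix η Z) Y
    Fix-⊓ Y = mk⇔ to from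
      where
      to : Fix (ρ ⊓ η) Y → UnionClosure (λ Z → Fix ρ Z ⊎ Fix η Z) Y
      to fix = Bool , _ , (λ { true → inj₁ (ρ.idempotent Y) ; false → inj₂ (η.idempotent Y) })
             , ≐-trans (≐-sym fix) (⊓≐⋃ Y)
      from : UnionClosure (λ Z → Fix ρ Z ⊎ Fix η Z) Y → Fix (ρ ⊓ η) Y
      from (I , Z , fixes , Y⊆⋃Z , ⋃Z⊆Y) = ⊓-reductive Y , λ y → member (Y⊆⋃Z y)
        where
        member : ⋃ I Z ⊆ (ρ ⊓ η) Y
        member (i , z) with fixes i
        ... | inj₁ fix = inj₁ (ρ.Fix⇒⊆-mono fix (⋃Z⊆Y ∘ (i ,_)) z)
        ... | inj₂ fix = inj₂ (η.Fix⇒⊆-mono fix (⋃Z⊆Y ∘ (i ,_)) z)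

  module Conjugation (f : Op) (f-mono : Monotone f) (f-involutive : ∀ X → f (f X) ≐ X) where

    conjugate : Op → Op
    conjugate ρ X = f (ρ (f X))

    f-resp-≐ : ∀ {X Y} → X ≐ Y → f X ≐ f Y
    f-resp-≐ (X⊆Y , Y⊆X) = f-mono X⊆Y , f-mono Y⊆X

    complete⇒Fix-f : ∀ {η} → IsUco η → Complete η f → ∀ {Z} → Fix η Z → Fix η (f Z)
    complete⇒Fix-f {η} η-uco complete {Z} fix = reductive (f Z) , fZ⊆ηfZ
      where
      open Uco η-uco
      Z⊆fηfZ : Z ⊆ f (η (f Z))
      Z⊆fηfZ = reductive (f (η (f Z))) ∘ proj₁ (complete (f Z))
             ∘ mono (proj₂ (f-involutive Z)) ∘ proj₂ fix
      fZ⊆ηfZ : f Z ⊆ η (f Z)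
      fZ⊆ηfZ = proj₁ (f-involutive (η (f Z))) ∘ f-mono Z⊆fηfZ

    module _ {ρ : Op} (ρ-uco : IsUco ρ) where
      open Uco ρ-uco

      conjugate-reductive : ∀ X → conjugate ρ X ⊆ X
      conjugate-reductive X = proj₁ (f-involutive X) ∘ f-mono (reductive (f X))

      conjugate-isUco : IsUco (conjugate ρ)
      conjugate-isUco = f-mono ∘ mono ∘ f-mono
                      , conjugate-reductive
                      , λ X → conjugate-reductive (conjugate ρ X)
                            , f-mono (mono (proj₂ (f-involutive (ρ (f X)))) ∘ idempotent-⊇ (f X))

      Fix-conjugate : ∀ Z → Fix (conjugate ρ) Z ⇔ Fix ρ (f Z)
      Fix-conjugate Z = mk⇔ (λ fix → ≐-trans (≐-sym (f-involutive (ρ (f Z)))) (f-resp-≐ fix))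
                            (λ fix → ≐-trans (f-resp-≐ fix) (f-involutive Z))

      open Meet ρ-uco conjugate-isUco

      ⊓-conjugate-complete : Complete (ρ ⊓ conjugate ρ) f
      ⊓-conjugate-complete X = [ inj₁ ∘ ρ-half , inj₂ ∘ conjugate-half ]
                             , Uco.mono ⊓-isUco (f-mono (⊓-reductive X))
        where
        ρ-half : ρ (f X) ⊆ ρ (f ((ρ ⊓ conjugate ρ) X))
        ρ-half = mono (f-mono inj₂ ∘ proj₂ (f-involutive (ρ (f X)))) ∘ idempotent-⊇ (f X)
        conjugate-half : conjugate ρ (f X) ⊆ conjugate ρ (f ((ρ ⊓ conjugate ρ) X))
        conjugate-half = f-mono (mono (proj₂ (f-involutive _) ∘ inj₁) ∘ idempotent-⊇ X
                                 ∘ mono (proj₁ (f-involutive X)))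

      below-⊓-conjugate : ∀ η → IsUco η → η ⊑ ρ → Complete η f → η ⊑ (ρ ⊓ conjugate ρ)
      below-⊓-conjugate η η-uco η⊑ρ complete X =
        [ η⊑ρ X , Uco.Fix⇒⊆-mono η-uco fix-conjugate (conjugate-reductive X) ]
        where
        fix-conjugate : Fix η (conjugate ρ X)
        fix-conjugate = complete⇒Fix-f η-uco complete (⊑-Fix η-uco η⊑ρ (idempotent (f X)))

      ⊓-conjugate-isCompleteShell : IsCompleteShell ρ f (ρ ⊓ conjugate ρ)
      ⊓-conjugate-isCompleteShell =
        ⊓-isUco , (λ X → inj₁) , ⊓-conjugate-complete , below-⊓-conjugate

      Fix-⊓-conjugate : ∀ Y → Fix (ρ ⊓ conjugate ρ) Y ⇔ UnionClosure (λ Z → Fix ρ Z ⊎ Fix ρ (f Z)) Y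
      Fix-⊓-conjugate Y = mk⇔ (UnionClosure-mono (λ Z → to (Fix-⊎-conjugate Z)))
                              (UnionClosure-mono (λ Z → from (Fix-⊎-conjugate Z)))
                          ⇔-∘ Fix-⊓ Y
        where
        open Equivalence
        Fix-⊎-conjugate : ∀ Z → (Fix ρ Z ⊎ Fix (conjugate ρ) Z) ⇔ (Fix ρ Z ⊎ Fix ρ (f Z))
        Fix-⊎-conjugate Z = mk⇔ (Sum.map₂ (to (Fix-conjugate Z))) (Sum.map₂ (from (Fix-conjugate Z)))

  ρ∀-isUco : ∀ N → IsUco (ρ∀ N)
  ρ∀-isUco N = (λ X⊆Y (n , all) → n , X⊆Y ∘ all)
             , (λ X (n , all) → all (n , refl))
             , λ X → (λ (n , all) → all (n , refl))
                   , λ (n , all) → n , λ (m , eq) → m , λ (m′ , eq′) → all (m′ , trans eq′ eq)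

  module Reversal (ext : Extensionality 0ℓ 0ℓ) where

    rev-involutive : ∀ t → rev (rev t) ≡ t
    rev-involutive (i , σ) = cong₂ _,_ (neg-involutive i) (ext λ k → cong σ (neg-involutive k))

    state-rev : ∀ t → state (rev t) ≡ state t
    state-rev (i , σ) = cong σ (neg-involutive i)

    ↶-mono : Monotone ↶
    ↶-mono X⊆Y (u , x , eq) = u , X⊆Y x , eq

    ↶-elim : ∀ {X t} → ↶ X t → X (rev t)
    ↶-elim {X} (u , x , refl) = subst X (sym (rev-involutive u)) x

    ↶-intro : ∀ {X t} → X (rev t) → ↶ X t
    ↶-intro {t = t} x = rev t , x , sym (rev-involutive t)

    ↶-involutive : ∀ X → ↶ (↶ X) ≐ X
    ↶-involutive X = subst X (rev-involutive _) ∘ ↶-elim ∘ ↶-elim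
                     , ↶-intro ∘ ↶-intro ∘ subst X (sym (rev-involutive _))

    open Conjugation ↶ ↶-mono ↶-involutive

    conjugate-ρ∀ : ∀ N X → conjugate (ρ∀ N) X ≐ ρ∀ (↶ N) X
    conjugate-ρ∀ N X = to , from
      where
      to : conjugate (ρ∀ N) X ⊆ ρ∀ (↶ N) X
      to (u , (n , all) , refl) = (u , n , refl) , λ { ((w , m , refl) , eq) →
        ↶-elim (all (m , trans (sym (state-rev w)) (trans eq (state-rev u)))) }
      from : ρ∀ (↶ N) X ⊆ conjugate (ρ∀ N) X
      from {t} (n , all) = ↶-intro (↶-elim n , λ { {w} (m , eq) →
        ↶-intro (all ((w , m , refl) , trans (state-rev w) (trans eq (state-rev t)))) })

theorem12 : Extensionality 0ℓ 0ℓ →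
    (S : Set) → let open Traces S in
    (M : TSet) → StandingHyp M →
    Σ Op λ η → IsCompleteShell (ρ∀ M) ↶ η
      × (∀ Y → Fix η Y ⇔ UnionClosure (λ Z → Fix (ρ∀ M) Z ⊎ Fix (ρ∀ M) (↶ Z)) Y)
      × (∀ X → η X ≐ (ρ∀ M ⊓ ρ∀ (↶ M)) X)
theorem12 ext S M _ = ρ∀ M ⊓ conjugate (ρ∀ M)
                    , ⊓-conjugate-isCompleteShell (ρ∀-isUco M)
                    , Fix-⊓-conjugate (ρ∀-isUco M)
                    , λ X → Sum.map₂ (proj₁ (conjugate-ρ∀ M X))
                          , Sum.map₂ (proj₂ (conjugate-ρ∀ M X))
  where
  open Traces S
  open ClosureTheory S
  open Reversal ext
  open Conjugation ↶ ↶-mono ↶-involutive
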